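{- Let $b\ge 2$ and $n\ge 0$ be integers. Then $R_b(n)$ contains every $b$-ary partition of $n$, and the ordered set $(R_b(n),\le)$ is a distributive lattice in which, for all $p,q\in R_b(n)$, the supremum $p\vee q$ and infimum $p\wedge q$ are the elements of $R_b(n)$ determined by $$s(p\vee q)_i=\min(s(p)_i,s(q)_i)\quad\text{and}\quad s(p\wedge q)_i=\max(s(p)_i,s(q)_i)\qquad\text{for all } i\ge 0.$$
   Context: For an integer $n\ge 0$, a $b$-ary partition of $n$ is a sequence $p=(p_0,p_1,p_2,\dots)$ of non-negative integers, only finitely many nonzero, with $\sum_{i\ge 0}p_ib^i=n$; it is written as a finite tuple $(p_0,\dots,p_{k-1})$, later components being $0$; $(n)$ denotes $(n,0,0,\dots)$. For $i\ge 0$ and a $b$-ary partition $p$ with $p_i\ge b$, "firing $i$" transforms $p$ into the $b$-ary partition $q$ with $q_i=p_i-b$, $q_{i+1}=p_{i+1}+1$ and $q_j=p_j$ for $j\notin\{i,i+1\}$. $R_b(n)$ is the set of $b$-ary partitions of $n$ obtainable from $(n)$ by a finite sequence of firings, ordered by: $p\le q$ iff $p$ is obtainable from $q$ by a finite (possibly empty) sequence of firings. For $p\in R_b(n)$, the number of firings of $i$ in a firing sequence from $(n)$ to $p$ does not depend on the chosen sequence; it is denoted $s(p)_i$ (the shot vector of $p$). -}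

module Defs where

open import Data.Nat using (ℕ; zero; suc; _+_; _*_; _^_; _≤_; _⊓_; _⊔_)
open import Data.Product using (Σ; _×_; ∃; _,_; proj₁)
open import Relation.Binary.PropositionalEquality using (_≡_; _≢_)
open import Relation.Nullary using (Dec; yes; no)
open import Data.Nat using (_≟_)

Seqℕ : Set
Seqℕ = ℕ → ℕ

bsum : ℕ → Seqℕ → ℕ → ℕ
bsum b p zero    = 0
bsum b p (suc k) = bsum b p k + p k * b ^ k

record BPartition (b n : ℕ) : Set where
  field
    part      : Seqℕ
    bound     : ℕ
    vanishing : ∀ j → bound ≤ j → part j ≡ 0
    value     : bsum b part bound ≡ n
open BPartition public

single : ℕ → Seqℕ
single n zero    = n
single n (suc _) = 0

record Fires (b i : ℕ) (p q : Seqℕ) : Set where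
  field
    enough : b ≤ p i
    at-i   : q i + b ≡ p i
    at-i+1 : q (suc i) ≡ p (suc i) + 1
    other  : ∀ j → j ≢ i → j ≢ suc i → q j ≡ p j

data FiringSeq (b : ℕ) : Seqℕ → Seqℕ → Set where
  done : ∀ {p q} → (∀ j → p j ≡ q j) → FiringSeq b p q
  step : ∀ {p q r} (i : ℕ) → Fires b i p q → FiringSeq b q r → FiringSeq b p r

count : ∀ {b p q} → ℕ → FiringSeq b p q → ℕ
count i (done _) = 0
count i (step j _ σ) with i ≟ j
... | yes _ = suc (count i σ)
... | no  _ = count i σ

R : ℕ → ℕ → Set
R b n = Σ (BPartition b n) (λ p → FiringSeq b (single n) (part p))

elt : ∀ {b n} → R b n → Seqℕ
elt x = part (proj₁ x)

_≈R_ : ∀ {b n} → R b n → R b n → Set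
x ≈R y = ∀ j → elt x j ≡ elt y j

_≤R_ : ∀ {b n} → R b n → R b n → Set
_≤R_ {b} x y = FiringSeq b (elt y) (elt x)

-- Record a reachable configuration by its shot vector s: starting from (n), the
-- partition reached is q_i = r_i − b s_i, where r_0 = n and r_i = s_{i−1} count the
-- chips received. So s determines q and, as b ≠ 0, q determines s. Every b-ary
-- partition q satisfies this with s_i = Σ_{j>i} q_j b^{j−i−1}, and the finitely
-- supported s with b s_i ≤ r_i are exactly the shot vectors that occur. If s ≤ t
-- pointwise, the configuration of s fires to that of t by repeatedly firing the
-- least index where s falls short of t: agreement just below it means that index
-- holds at least b chips. Hence p ≤ q iff s(q) ≤ s(p) pointwise, and since the
-- condition b s_i ≤ r_i is preserved by pointwise min and max, R_b(n) is
-- anti-isomorphic to a sublattice of (ℕ^ℕ, ⊓, ⊔), which is distributive.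
module Submission where

open import Defs
open import Data.Nat using (ℕ; zero; suc; _+_; _*_; _∸_; _^_; _≤_; _<_; z≤n; s≤s; z<s; _⊓_; _⊔_; _≟_; NonZero)
open import Data.Nat.Properties
open import Data.Nat.Tactic.RingSolver using (solve-∀)
open import Data.Product using (Σ; _×_; _,_; proj₁)
open import Data.Sum using (inj₁; inj₂)
open import Data.Empty using (⊥-elim)
open import Relation.Nullary using (Dec; yes; no)
open import Relation.Binary.Definitions using (tri<; tri≈; tri>)
open import Algebra.Core using (Op₂)
open import Relation.Binary.PropositionalEquality
open import Relation.Binary.Lattice.Structures using (IsDistributiveLattice)

_⊓ₛ_ : Seqℕ → Seqℕ → Seqℕ
(s ⊓ₛ t) i = s i ⊓ t i

_⊔ₛ_ : Seqℕ → Seqℕ → Seqℕ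
(s ⊔ₛ t) i = s i ⊔ t i

VanishesFrom : ℕ → Seqℕ → Set
VanishesFrom B s = ∀ i → B ≤ i → s i ≡ 0

vanishesFrom-⊓ : ∀ {B C s t} → VanishesFrom B s → VanishesFrom C t → VanishesFrom (B ⊔ C) (s ⊓ₛ t)
vanishesFrom-⊓ {B} {C} {t = t} vs vt i B⊔C≤i = cong (_⊓ t i) (vs i (≤-trans (m≤m⊔n B C) B⊔C≤i))

vanishesFrom-⊔ : ∀ {B C s t} → VanishesFrom B s → VanishesFrom C t → VanishesFrom (B ⊔ C) (s ⊔ₛ t)
vanishesFrom-⊔ {B} {C} vs vt i B⊔C≤i =
  cong₂ _⊔_ (vs i (≤-trans (m≤m⊔n B C) B⊔C≤i)) (vt i (≤-trans (m≤n⊔m B C) B⊔C≤i))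

-- Branching on k ≟ j exactly as count does keeps bump and count in step.
bump : Seqℕ → ℕ → Seqℕ
bump s j k with k ≟ j
... | yes _ = suc (s k)
... | no  _ = s k

bump-≡ : ∀ s j → bump s j j ≡ suc (s j)
bump-≡ s j with j ≟ j
... | yes _  = refl
... | no j≢j = ⊥-elim (j≢j refl)

bump-≢ : ∀ s {j k} → k ≢ j → bump s j k ≡ s k
bump-≢ s {j} {k} k≢j with k ≟ j
... | yes k≡j = ⊥-elim (k≢j k≡j)
... | no  _   = refl

module ShotVectors (b : ℕ) .{{_ : NonZero b}} (n : ℕ) where

  received : Seqℕ → Seqℕ
  received s zero    = n
  received s (suc i) = s i

  IsShotVector : Seqℕ → Seqℕ → Set
  IsShotVector s q = ∀ i → q i + b * s i ≡ received s i

  received-cong : ∀ {s t} → (∀ i → s i ≡ t i) → ∀ i → received s i ≡ received t i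
  received-cong s≗t zero    = refl
  received-cong s≗t (suc i) = s≗t i

  received-⊓ : ∀ s t i → received (s ⊓ₛ t) i ≡ received s i ⊓ received t i
  received-⊓ s t zero    = sym (⊓-idem n)
  received-⊓ s t (suc i) = refl

  received-⊔ : ∀ s t i → received (s ⊔ₛ t) i ≡ received s i ⊔ received t i
  received-⊔ s t zero    = sym (⊔-idem n)
  received-⊔ s t (suc i) = refl

  received-bump : ∀ s {j i} → i ≢ suc j → received (bump s j) i ≡ received s i
  received-bump s {i = zero}  _      = refl
  received-bump s {i = suc k} k+1≢j+1 = bump-≢ s (λ k≡j → k+1≢j+1 (cong suc k≡j))

  isShotVector-cong : ∀ {s t q r} → (∀ i → s i ≡ t i) → (∀ i → q i ≡ r i) →
                      IsShotVector s q → IsShotVector t r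
  isShotVector-cong {s} {t} s≗t q≗r sh i =
    trans (cong₂ (λ x y → x + b * y) (sym (q≗r i)) (sym (s≗t i)))
          (trans (sh i) (received-cong s≗t i))

  shotVector-injective : ∀ {s t q} → IsShotVector s q → IsShotVector t q → ∀ i → s i ≡ t i
  shotVector-injective {s} {t} {q} shs sht i =
    *-cancelˡ-≡ (s i) (t i) b (+-cancelˡ-≡ (q i) _ _ (trans (shs i) (trans (received≡ i) (sym (sht i)))))
    where
    received≡ : ∀ i → received s i ≡ received t i
    received≡ zero    = refl
    received≡ (suc i) = shotVector-injective shs sht i

  shotVector-functional : ∀ {s q r} → IsShotVector s q → IsShotVector s r → ∀ i → q i ≡ r i
  shotVector-functional {s} shq shr i = +-cancelʳ-≡ (b * s i) _ _ (trans (shq i) (sym (shr i)))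

  isShotVector-single : IsShotVector (λ _ → 0) (single n)
  isShotVector-single zero    = trans (cong (n +_) (*-zeroʳ b)) (+-identityʳ n)
  isShotVector-single (suc k) = *-zeroʳ b

  isShotVector-fire : ∀ {s q r j} → Fires b j q r → IsShotVector s q → IsShotVector (bump s j) r
  isShotVector-fire {s} {q} {r} {j} f sh i = byCases (i ≟ j) (i ≟ suc j)
    where
    open ≡-Reasoning
    goal = r i + b * bump s j i ≡ received (bump s j) i
    +-comm-middle : ∀ x y z → x + y + z ≡ x + z + y
    +-comm-middle = solve-∀
    byCases : Dec (i ≡ j) → Dec (i ≡ suc j) → goal
    byCases (yes refl) _ = begin
      r i + b * bump s i i   ≡⟨ cong (λ x → r i + b * x) (bump-≡ s i) ⟩
      r i + b * suc (s i)    ≡⟨ cong (r i +_) (*-suc b (s i)) ⟩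
      r i + (b + b * s i)    ≡⟨ sym (+-assoc (r i) b (b * s i)) ⟩
      r i + b + b * s i      ≡⟨ cong (_+ b * s i) (Fires.at-i f) ⟩
      q i + b * s i          ≡⟨ sh i ⟩
      received s i           ≡⟨ sym (received-bump s {i} {i} (λ i≡1+i → 1+n≢n (sym i≡1+i))) ⟩
      received (bump s i) i  ∎
    byCases (no i≢j) (yes refl) = begin
      r (suc j) + b * bump s j (suc j)  ≡⟨ cong (λ x → r (suc j) + b * x) (bump-≢ s i≢j) ⟩
      r (suc j) + b * s (suc j)         ≡⟨ cong (_+ b * s (suc j)) (Fires.at-i+1 f) ⟩
      q (suc j) + 1 + b * s (suc j)     ≡⟨ +-comm-middle (q (suc j)) 1 (b * s (suc j)) ⟩
      q (suc j) + b * s (suc j) + 1     ≡⟨ cong (_+ 1) (sh (suc j)) ⟩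
      s j + 1                           ≡⟨ +-comm (s j) 1 ⟩
      suc (s j)                         ≡⟨ sym (bump-≡ s j) ⟩
      bump s j j                        ∎
    byCases (no i≢j) (no i≢1+j) = begin
      r i + b * bump s j i   ≡⟨ cong₂ (λ x y → x + b * y) (Fires.other f i i≢j i≢1+j) (bump-≢ s i≢j) ⟩
      q i + b * s i          ≡⟨ sh i ⟩
      received s i           ≡⟨ sym (received-bump s {j} {i} i≢1+j) ⟩
      received (bump s j) i  ∎

  isShotVector-firingSeq : ∀ {s q r} (σ : FiringSeq b q r) → IsShotVector s q →
                           IsShotVector (λ i → s i + count i σ) r
  isShotVector-firingSeq {s} (done q≗r) sh = isShotVector-cong (λ i → sym (+-identityʳ (s i))) q≗r sh
  isShotVector-firingSeq {s} (step j f σ) sh =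
    isShotVector-cong bump-count (λ _ → refl) (isShotVector-firingSeq σ (isShotVector-fire f sh))
    where
    bump-count : ∀ i → bump s j i + count i σ ≡ s i + count i (step j f σ)
    bump-count i with i ≟ j
    ... | yes _ = sym (+-suc (s i) (count i σ))
    ... | no  _ = refl

  count≡shotVector : ∀ {s q} (σ : FiringSeq b (single n) q) → IsShotVector s q → ∀ i → count i σ ≡ s i
  count≡shotVector σ = shotVector-injective (isShotVector-firingSeq σ isShotVector-single)

  horner : Seqℕ → ℕ → ℕ → ℕ
  horner q zero    j = 0
  horner q (suc m) j = q j + b * horner q m (suc j)

  horner-snoc : ∀ q m j → horner q (suc m) j ≡ horner q m j + q (j + m) * b ^ m
  horner-snoc q zero j = begin
    q j + b * 0      ≡⟨ cong (q j +_) (*-zeroʳ b) ⟩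
    q j + 0          ≡⟨ +-identityʳ (q j) ⟩
    q j              ≡⟨ sym (*-identityʳ (q j)) ⟩
    q j * 1          ≡⟨ cong (λ k → q k * 1) (sym (+-identityʳ j)) ⟩
    q (j + 0) * 1    ∎
    where open ≡-Reasoning
  horner-snoc q (suc m) j = begin
    q j + b * horner q (suc m) (suc j)
      ≡⟨ cong (λ x → q j + b * x) (horner-snoc q m (suc j)) ⟩
    q j + b * (horner q m (suc j) + q (suc j + m) * b ^ m)
      ≡⟨ distrib (q j) (horner q m (suc j)) (q (suc j + m)) (b ^ m) b ⟩
    horner q (suc m) j + q (suc j + m) * (b * b ^ m)
      ≡⟨ cong (λ k → horner q (suc m) j + q k * b ^ suc m) (sym (+-suc j m)) ⟩
    horner q (suc m) j + q (j + suc m) * b ^ suc m  ∎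
    where
    open ≡-Reasoning
    distrib : ∀ a x y p c → a + c * (x + y * p) ≡ (a + c * x) + y * (c * p)
    distrib = solve-∀

  bsum≡horner : ∀ q m → bsum b q m ≡ horner q m 0
  bsum≡horner q zero    = refl
  bsum≡horner q (suc m) = trans (cong (_+ q m * b ^ m) (bsum≡horner q m)) (sym (horner-snoc q m 0))

  horner-vanishing : ∀ {B q} → VanishesFrom B q → ∀ m j → B ≤ j → horner q m j ≡ 0
  horner-vanishing vq zero    j B≤j = refl
  horner-vanishing vq (suc m) j B≤j =
    trans (cong₂ (λ x y → x + b * y) (vq j B≤j) (horner-vanishing vq m (suc j) (m≤n⇒m≤1+n B≤j)))
          (*-zeroʳ b)

  shotVectorOf : BPartition b n → Seqℕ
  shotVectorOf P i = horner (part P) (bound P) (suc i)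

  isShotVector-shotVectorOf : (P : BPartition b n) → IsShotVector (shotVectorOf P) (part P)
  isShotVector-shotVectorOf P i = begin
    q i + b * horner q B (suc i)  ≡⟨ horner-snoc q B i ⟩
    horner q B i + q (i + B) * b ^ B
      ≡⟨ cong (λ x → horner q B i + x * b ^ B) (vanishing P (i + B) (m≤n+m B i)) ⟩
    horner q B i + 0              ≡⟨ +-identityʳ (horner q B i) ⟩
    horner q B i                  ≡⟨ horner≡received i ⟩
    received (shotVectorOf P) i   ∎
    where
    open ≡-Reasoning
    q = part P
    B = bound P
    horner≡received : ∀ i → horner q B i ≡ received (shotVectorOf P) i
    horner≡received zero    = trans (sym (bsum≡horner q B)) (value P)
    horner≡received (suc k) = refl

  shotVectorOf-vanishing : (P : BPartition b n) → VanishesFrom (bound P) (shotVectorOf P)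
  shotVectorOf-vanishing P i B≤i = horner-vanishing (vanishing P) (bound P) (suc i) (m≤n⇒m≤1+n B≤i)

  Admissible : Seqℕ → Set
  Admissible s = ∀ i → b * s i ≤ received s i

  admissible : ∀ {s q} → IsShotVector s q → Admissible s
  admissible {s} {q} sh i = subst (b * s i ≤_) (sh i) (m≤n+m (b * s i) (q i))

  admissible-⊓ : ∀ {s t} → Admissible s → Admissible t → Admissible (s ⊓ₛ t)
  admissible-⊓ {s} {t} as at i =
    subst₂ _≤_ (sym (*-distribˡ-⊓ b (s i) (t i))) (sym (received-⊓ s t i)) (⊓-mono-≤ (as i) (at i))

  admissible-⊔ : ∀ {s t} → Admissible s → Admissible t → Admissible (s ⊔ₛ t)
  admissible-⊔ {s} {t} as at i =
    subst₂ _≤_ (sym (*-distribˡ-⊔ b (s i) (t i))) (sym (received-⊔ s t i)) (⊔-mono-≤ (as i) (at i))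

  configuration : Seqℕ → Seqℕ
  configuration s i = received s i ∸ b * s i

  isShotVector-configuration : ∀ {s} → Admissible s → IsShotVector s (configuration s)
  isShotVector-configuration as i = m∸n+n≡m (as i)

  bsum-telescope : ∀ {s q} → IsShotVector s q → ∀ m → bsum b q m + b ^ m * received s m ≡ n
  bsum-telescope sh zero = +-identityʳ n
  bsum-telescope {s} {q} sh (suc m) = begin
    bsum b q m + q m * b ^ m + b ^ suc m * s m   ≡⟨ regroup (bsum b q m) (q m) (b ^ m) (s m) b ⟩
    bsum b q m + b ^ m * (q m + b * s m)         ≡⟨ cong (λ x → bsum b q m + b ^ m * x) (sh m) ⟩
    bsum b q m + b ^ m * received s m            ≡⟨ bsum-telescope sh m ⟩
    n                                            ∎
    where
    open ≡-Reasoning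
    regroup : ∀ x y p z c → x + y * p + (c * p) * z ≡ x + p * (y + c * z)
    regroup = solve-∀

  partitionOf : ∀ {s} B → VanishesFrom B s → Admissible s → BPartition b n
  partitionOf {s} B vs as = record
    { part = configuration s ; bound = suc B ; vanishing = vanishing′ ; value = value′ }
    where
    vanishing′ : VanishesFrom (suc B) (configuration s)
    vanishing′ (suc k) (s≤s B≤k) = trans (cong (_∸ b * s (suc k)) (vs k B≤k)) (0∸n≡0 (b * s (suc k)))
    value′ : bsum b (configuration s) (suc B) ≡ n
    value′ = begin
      bsum b (configuration s) (suc B)
        ≡⟨ sym (+-identityʳ _) ⟩
      bsum b (configuration s) (suc B) + 0
        ≡⟨ cong (bsum b (configuration s) (suc B) +_) (sym (trans (cong (b ^ suc B *_) (vs B ≤-refl)) (*-zeroʳ (b ^ suc B)))) ⟩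
      bsum b (configuration s) (suc B) + b ^ suc B * s B
        ≡⟨ bsum-telescope (isShotVector-configuration as) (suc B) ⟩
      n ∎
      where open ≡-Reasoning

  fire : Seqℕ → ℕ → Seqℕ
  fire q i k with k ≟ i | k ≟ suc i
  ... | yes _ | _     = q k ∸ b
  ... | no  _ | yes _ = q k + 1
  ... | no  _ | no  _ = q k

  fires-fire : ∀ {q i} → b ≤ q i → Fires b i q (fire q i)
  fires-fire {q} {i} b≤qi = record { enough = b≤qi ; at-i = at-i ; at-i+1 = at-i+1 ; other = other }
    where
    at-i : fire q i i + b ≡ q i
    at-i with i ≟ i
    ... | yes _  = m∸n+n≡m b≤qi
    ... | no i≢i = ⊥-elim (i≢i refl)
    at-i+1 : fire q i (suc i) ≡ q (suc i) + 1
    at-i+1 with suc i ≟ i | suc i ≟ suc i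
    ... | yes 1+i≡i | _ = ⊥-elim (1+n≢n 1+i≡i)
    ... | no _ | yes _  = refl
    ... | no _ | no ≢   = ⊥-elim (≢ refl)
    other : ∀ j → j ≢ i → j ≢ suc i → fire q i j ≡ q j
    other j j≢i j≢1+i with j ≟ i | j ≟ suc i
    ... | yes j≡i | _       = ⊥-elim (j≢i j≡i)
    ... | no _    | yes j≡1+i = ⊥-elim (j≢1+i j≡1+i)
    ... | no _    | no _    = refl

  enough-to-fire : ∀ {q r x y} → q + b * x ≡ r + b * y → x < y → b ≤ q
  enough-to-fire {q} {r} {x} {y} eq x<y = +-cancelʳ-≤ (b * x) b q (begin
    b + b * x   ≡⟨ sym (*-suc b x) ⟩
    b * suc x   ≤⟨ *-monoʳ-≤ b x<y ⟩
    b * y       ≤⟨ m≤n+m (b * y) r ⟩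
    r + b * y   ≡⟨ sym eq ⟩
    q + b * x   ∎)
    where open ≤-Reasoning

  received-agree : ∀ {s t} i → (∀ k → k < i → s k ≡ t k) → received s i ≡ received t i
  received-agree zero    _     = refl
  received-agree (suc i) below = below i ≤-refl

  -- The recursion is lexicographic: on the remaining length m of the support of t,
  -- and at a fixed i on the remaining shortfall d = t i ∸ s i.
  module _ {t r} (shr : IsShotVector t r) where
    fireUpTo : ∀ m d i {s q} → IsShotVector s q → (∀ k → k < i → s k ≡ t k) → s i + d ≡ t i →
               (∀ k → i < k → s k ≤ t k) → VanishesFrom (m + i) t → FiringSeq b q r
    fireUpTo zero zero i {s} sh below at above vt =
      done (shotVector-functional (isShotVector-cong s≗t (λ _ → refl) sh) shr)
      where
      s≗t : ∀ k → s k ≡ t k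
      s≗t k with <-cmp k i
      ... | tri< k<i _ _    = below k k<i
      ... | tri≈ _ refl _   = trans (sym (+-identityʳ (s k))) at
      ... | tri> _ _ i<k    = trans (n≤0⇒n≡0 (subst (s k ≤_) tk≡0 (above k i<k))) (sym tk≡0)
        where tk≡0 = vt k (<⇒≤ i<k)
    fireUpTo (suc m) zero i {s} sh below at above vt =
      fireUpTo m (t (suc i) ∸ s (suc i)) (suc i) sh below′ (m+[n∸m]≡n (above (suc i) ≤-refl))
        (λ k 1+i<k → above k (<-trans (n<1+n i) 1+i<k))
        (λ k m+1+i≤k → vt k (subst (_≤ k) (+-suc m i) m+1+i≤k))
      where
      below′ : ∀ k → k < suc i → s k ≡ t k
      below′ k k<1+i with m<1+n⇒m<n∨m≡n k<1+i
      ... | inj₁ k<i  = below k k<i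
      ... | inj₂ refl = trans (sym (+-identityʳ (s k))) at
    fireUpTo m (suc d) i {s} {q} sh below at above vt =
      step i firing (fireUpTo m d i (isShotVector-fire firing sh) below′ at′ above′ vt)
      where
      si<ti : s i < t i
      si<ti = subst (s i <_) at (m<m+n (s i) z<s)
      firing : Fires b i q (fire q i)
      firing = fires-fire (enough-to-fire (trans (sh i) (trans (received-agree i below) (sym (shr i)))) si<ti)
      below′ : ∀ k → k < i → bump s i k ≡ t k
      below′ k k<i = trans (bump-≢ s (<⇒≢ k<i)) (below k k<i)
      at′ : bump s i i + d ≡ t i
      at′ = trans (cong (_+ d) (bump-≡ s i)) (trans (sym (+-suc (s i) d)) at)
      above′ : ∀ k → i < k → bump s i k ≤ t k
      above′ k i<k = subst (_≤ t k) (sym (bump-≢ s (>⇒≢ i<k))) (above k i<k)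

  shotVector-≤⇒firingSeq : ∀ {s q t r B} → IsShotVector s q → IsShotVector t r → (∀ i → s i ≤ t i) →
                           VanishesFrom B t → FiringSeq b q r
  shotVector-≤⇒firingSeq {s} {t = t} {B = B} shq shr s≤t vt =
    fireUpTo shr B (t 0 ∸ s 0) 0 shq (λ _ ()) (m+[n∸m]≡n (s≤t 0)) (λ k _ → s≤t k)
      (λ k B+0≤k → vt k (subst (_≤ k) (+-identityʳ B) B+0≤k))

  reachable : (P : BPartition b n) → FiringSeq b (single n) (part P)
  reachable P = shotVector-≤⇒firingSeq isShotVector-single (isShotVector-shotVectorOf P) (λ _ → z≤n)
                  (shotVectorOf-vanishing P)

  shot : R b n → Seqℕ
  shot x = shotVectorOf (proj₁ x)

  isShotVector-shot : ∀ x → IsShotVector (shot x) (elt x)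
  isShotVector-shot x = isShotVector-shotVectorOf (proj₁ x)

  shot-vanishing : ∀ x → VanishesFrom (bound (proj₁ x)) (shot x)
  shot-vanishing x = shotVectorOf-vanishing (proj₁ x)

  shot-admissible : ∀ x → Admissible (shot x)
  shot-admissible x = admissible (isShotVector-shot x)

  count≡shot : ∀ x (σ : FiringSeq b (single n) (elt x)) i → count i σ ≡ shot x i
  count≡shot x σ = count≡shotVector σ (isShotVector-shot x)

  ≤R⇒shot≥ : ∀ {x y} → x ≤R y → ∀ i → shot y i ≤ shot x i
  ≤R⇒shot≥ {x} {y} σ i =
    subst (shot y i ≤_) (shotVector-injective (isShotVector-firingSeq σ (isShotVector-shot y)) (isShotVector-shot x) i)
      (m≤m+n (shot y i) (count i σ))

  shot≥⇒≤R : ∀ {x y} → (∀ i → shot y i ≤ shot x i) → x ≤R y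
  shot≥⇒≤R {x} {y} shot≥ =
    shotVector-≤⇒firingSeq (isShotVector-shot y) (isShotVector-shot x) shot≥ (shot-vanishing x)

  ≈R⇒shot≡ : ∀ {x y} → x ≈R y → ∀ i → shot x i ≡ shot y i
  ≈R⇒shot≡ {x} {y} x≈y =
    shotVector-injective (isShotVector-shot x) (isShotVector-cong (λ _ → refl) (λ j → sym (x≈y j)) (isShotVector-shot y))

  shot≡⇒≈R : ∀ {x y} → (∀ i → shot x i ≡ shot y i) → x ≈R y
  shot≡⇒≈R {x} {y} shot≡ =
    shotVector-functional (isShotVector-cong shot≡ (λ _ → refl) (isShotVector-shot x)) (isShotVector-shot y)

  fromShotVector : ∀ {s} B → VanishesFrom B s → Admissible s → R b n
  fromShotVector B vs as = partitionOf B vs as , reachable (partitionOf B vs as)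

  shot-fromShotVector : ∀ {s} B (vs : VanishesFrom B s) (as : Admissible s) → ∀ i → shot (fromShotVector B vs as) i ≡ s i
  shot-fromShotVector B vs as = shotVector-injective (isShotVector-shot (fromShotVector B vs as)) (isShotVector-configuration as)

  bound₂ : R b n → R b n → ℕ
  bound₂ x y = bound (proj₁ x) ⊔ bound (proj₁ y)

  _∨_ : Op₂ (R b n)
  x ∨ y = fromShotVector (bound₂ x y)
    (vanishesFrom-⊓ (shot-vanishing x) (shot-vanishing y)) (admissible-⊓ (shot-admissible x) (shot-admissible y))

  _∧_ : Op₂ (R b n)
  x ∧ y = fromShotVector (bound₂ x y)
    (vanishesFrom-⊔ (shot-vanishing x) (shot-vanishing y)) (admissible-⊔ (shot-admissible x) (shot-admissible y))

  shot-∨ : ∀ x y i → shot (x ∨ y) i ≡ shot x i ⊓ shot y i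
  shot-∨ x y = shot-fromShotVector (bound₂ x y)
    (vanishesFrom-⊓ (shot-vanishing x) (shot-vanishing y)) (admissible-⊓ (shot-admissible x) (shot-admissible y))

  shot-∧ : ∀ x y i → shot (x ∧ y) i ≡ shot x i ⊔ shot y i
  shot-∧ x y = shot-fromShotVector (bound₂ x y)
    (vanishesFrom-⊔ (shot-vanishing x) (shot-vanishing y)) (admissible-⊔ (shot-admissible x) (shot-admissible y))

  isDistributiveLattice : IsDistributiveLattice (_≈R_ {b} {n}) (_≤R_ {b} {n}) _∨_ _∧_
  isDistributiveLattice = record
    { isLattice = record
      { isPartialOrder = record
        { isPreorder = record
          { isEquivalence = record
            { refl  = λ _ → refl
            ; sym   = λ x≈y j → sym (x≈y j)
            ; trans = λ x≈y y≈z j → trans (x≈y j) (y≈z j)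
            }
          ; reflexive = λ {x} {y} x≈y → shot≥⇒≤R {x} {y} (λ i → ≤-reflexive (sym (≈R⇒shot≡ {x} {y} x≈y i)))
          ; trans     = λ {x} {y} {z} x≤y y≤z →
              shot≥⇒≤R {x} {z} (λ i → ≤-trans (≤R⇒shot≥ {y} {z} y≤z i) (≤R⇒shot≥ {x} {y} x≤y i))
          }
        ; antisym = λ {x} {y} x≤y y≤x →
          shot≡⇒≈R {x} {y} (λ i → ≤-antisym (≤R⇒shot≥ {y} {x} y≤x i) (≤R⇒shot≥ {x} {y} x≤y i))
        }
      ; supremum = λ x y →
          shot≥⇒≤R {x} {x ∨ y} (λ i → ≤-trans (≤-reflexive (shot-∨ x y i)) (m⊓n≤m (shot x i) (shot y i)))
        , shot≥⇒≤R {y} {x ∨ y} (λ i → ≤-trans (≤-reflexive (shot-∨ x y i)) (m⊓n≤n (shot x i) (shot y i)))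
        , λ z x≤z y≤z → shot≥⇒≤R {x ∨ y} {z} (λ i →
            ≤-trans (⊓-glb (≤R⇒shot≥ {x} {z} x≤z i) (≤R⇒shot≥ {y} {z} y≤z i)) (≤-reflexive (sym (shot-∨ x y i))))
      ; infimum = λ x y →
          shot≥⇒≤R {x ∧ y} {x} (λ i → ≤-trans (m≤m⊔n (shot x i) (shot y i)) (≤-reflexive (sym (shot-∧ x y i))))
        , shot≥⇒≤R {x ∧ y} {y} (λ i → ≤-trans (m≤n⊔m (shot x i) (shot y i)) (≤-reflexive (sym (shot-∧ x y i))))
        , λ z z≤x z≤y → shot≥⇒≤R {z} {x ∧ y} (λ i →
            ≤-trans (≤-reflexive (shot-∧ x y i)) (⊔-lub (≤R⇒shot≥ {z} {x} z≤x i) (≤R⇒shot≥ {z} {y} z≤y i)))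
      }
    ; ∧-distribˡ-∨ = λ x y z → shot≡⇒≈R {x ∧ (y ∨ z)} {(x ∧ y) ∨ (x ∧ z)} (λ i → begin
        shot (x ∧ (y ∨ z)) i                       ≡⟨ shot-∧ x (y ∨ z) i ⟩
        shot x i ⊔ shot (y ∨ z) i                  ≡⟨ cong (shot x i ⊔_) (shot-∨ y z i) ⟩
        shot x i ⊔ (shot y i ⊓ shot z i)           ≡⟨ ⊔-distribˡ-⊓ (shot x i) (shot y i) (shot z i) ⟩
        (shot x i ⊔ shot y i) ⊓ (shot x i ⊔ shot z i)
          ≡⟨ sym (cong₂ _⊓_ (shot-∧ x y i) (shot-∧ x z i)) ⟩
        shot (x ∧ y) i ⊓ shot (x ∧ z) i            ≡⟨ sym (shot-∨ (x ∧ y) (x ∧ z) i) ⟩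
        shot ((x ∧ y) ∨ (x ∧ z)) i                 ∎)
    }
    where open ≡-Reasoning

theorem1 : (b n : ℕ) → 2 ≤ b →
    ((p : BPartition b n) → FiringSeq b (single n) (part p))
    × Σ (Op₂ (R b n)) (λ _∨_ → Σ (Op₂ (R b n)) (λ _∧_ →
        IsDistributiveLattice (_≈R_ {b} {n}) (_≤R_ {b} {n}) _∨_ _∧_
        × ((x y : R b n) (i : ℕ) (σ : FiringSeq b (single n) (elt (x ∨ y)))
             (σx : FiringSeq b (single n) (elt x)) (σy : FiringSeq b (single n) (elt y)) →
             count i σ ≡ count i σx ⊓ count i σy)
        × ((x y : R b n) (i : ℕ) (σ : FiringSeq b (single n) (elt (x ∧ y)))
             (σx : FiringSeq b (single n) (elt x)) (σy : FiringSeq b (single n) (elt y)) →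
             count i σ ≡ count i σx ⊔ count i σy)))
theorem1 b@(suc _) n _ = reachable , _∨_ , _∧_ , isDistributiveLattice , count-∨ , count-∧
  where
  open ShotVectors b n
  count-∨ : ∀ x y i σ σx σy → count i σ ≡ count i σx ⊓ count i σy
  count-∨ x y i σ σx σy = trans (count≡shot (x ∨ y) σ i)
    (trans (shot-∨ x y i) (sym (cong₂ _⊓_ (count≡shot x σx i) (count≡shot y σy i))))
  count-∧ : ∀ x y i σ σx σy → count i σ ≡ count i σx ⊔ count i σy
  count-∧ x y i σ σx σy = trans (count≡shot (x ∧ y) σ i)
    (trans (shot-∧ x y i) (sym (cong₂ _⊔_ (count≡shot x σx i) (count≡shot y σy i))))
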